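{- For all integers $n \geq 100$ and all positive integers $r$, $$f(n, 3, r) = \begin{cases} \infty & \text{if } r \leq \lfloor \binom{n}{2}/3 \rfloor, \\ 2 & \text{if } \lfloor \binom{n}{2}/3 \rfloor < r \leq \binom{n}{2}, \\ 1 & \text{if } r > \binom{n}{2}. \end{cases}$$
   Context: Graphs may have loops and parallel edges. An edge-coloured graph is simple if no colour class contains two parallel edges (edges of different colours may be parallel). A loop is a cycle of length 1 and two parallel edges form a cycle of length 2. A subgraph of an edge-coloured graph is rainbow if no two of its edges have the same colour. The rainbow girth $\mathrm{rg}(G)$ of an edge-coloured graph $G$ is the length of a shortest rainbow cycle in $G$, with $\mathrm{rg}(G) = \infty$ if $G$ has no rainbow cycle. For positive integers $n,t,r$, $f(n,t,r)$ is the maximum of $\mathrm{rg}(G)$ over all simple edge-coloured graphs $G$ with $n$ vertices and at least $t$ colours in which every colour class has size at least $r$. -}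

module Defs where

open import Data.Nat using (ℕ; zero; suc; _≤_; _<_; _/_)
open import Data.Nat.Combinatorics using (_C_)
open import Data.Fin using (Fin; zero; suc; fromℕ; inject₁)
open import Data.Product using (Σ; ∃; _×_; _,_; proj₁; proj₂)
open import Data.Sum using (_⊎_)
open import Data.List using (List; length; lookup; filter)
open import Data.Nat.Properties using (_≟_)
open import Relation.Nullary using (¬_)
open import Data.Empty using (⊥)
open import Relation.Binary.PropositionalEquality using (_≡_; _≢_)
open import Function.Definitions using (Injective)

record Edge (n : ℕ) : Set where
  constructor edge
  field
    end₁   : Fin n
    end₂   : Fin n
    colour : ℕ
open Edge public

-- An edge-coloured multigraph on n vertices: a finite list of coloured edges
-- (distinct list positions are distinct edges, so parallel edges are allowed).
ECGraph : ℕ → Set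
ECGraph n = List (Edge n)

EdgeIx : ∀ {n} → ECGraph n → Set
EdgeIx G = Fin (length G)

col : ∀ {n} (G : ECGraph n) → EdgeIx G → ℕ
col G i = colour (lookup G i)

Joins : ∀ {n} (G : ECGraph n) → EdgeIx G → Fin n → Fin n → Set
Joins G i a b =
  (end₁ (lookup G i) ≡ a × end₂ (lookup G i) ≡ b) ⊎
  (end₁ (lookup G i) ≡ b × end₂ (lookup G i) ≡ a)

Parallel : ∀ {n} (G : ECGraph n) → EdgeIx G → EdgeIx G → Set
Parallel G i j =
  end₁ (lookup G i) ≢ end₂ (lookup G i) ×
  Joins G j (end₁ (lookup G i)) (end₂ (lookup G i))

Simple : ∀ {n} → ECGraph n → Set
Simple G = ∀ i j → i ≢ j → col G i ≡ col G j → ¬ Parallel G i j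

Used : ∀ {n} → ECGraph n → ℕ → Set
Used G c = ∃ λ i → col G i ≡ c

classSize : ∀ {n} → ECGraph n → ℕ → ℕ
classSize G c = length (filter (λ e → colour e ≟ c) G)

AtLeastColours : ∀ {n} → ECGraph n → ℕ → Set
AtLeastColours G t = Σ (Fin t → ℕ) λ cs → Injective _≡_ _≡_ cs × (∀ k → Used G (cs k))

ClassesAtLeast : ∀ {n} → ECGraph n → ℕ → Set
ClassesAtLeast G r = ∀ c → Used G c → r ≤ classSize G c

Admissible : (n t r : ℕ) → ECGraph n → Set
Admissible n t r G = Simple G × AtLeastColours G t × ClassesAtLeast G r

-- A rainbow cycle of length k ≥ 1: distinct vertices vs 0, …, vs (k-1)
-- (with vs k = vs 0) and edges es i joining vs i and vs (i+1), whose
-- colours are pairwise distinct (hence the edges are distinct).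
RainbowCycle : ∀ {n} → ECGraph n → ℕ → Set
RainbowCycle {n} G zero = ⊥
RainbowCycle {n} G (suc m) =
  Σ (Fin (suc (suc m)) → Fin n) λ vs →
  Σ (Fin (suc m) → EdgeIx G) λ es →
    vs (fromℕ (suc m)) ≡ vs zero ×
    Injective _≡_ _≡_ (λ i → vs (inject₁ i)) ×
    (∀ i → Joins G (es i) (vs (inject₁ i)) (vs (suc i))) ×
    Injective _≡_ _≡_ (λ i → col G (es i))

data ℕ∞ : Set where
  fin : ℕ → ℕ∞
  ∞   : ℕ∞

data _≤∞_ : ℕ∞ → ℕ∞ → Set where
  fin≤fin : ∀ {a b} → a ≤ b → fin a ≤∞ fin b
  _≤∞∞    : ∀ x → x ≤∞ ∞

RainbowGirth : ∀ {n} → ECGraph n → ℕ∞ → Set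
RainbowGirth G ∞       = ∀ k → ¬ RainbowCycle G k
RainbowGirth G (fin k) = RainbowCycle G k × (∀ j → RainbowCycle G j → k ≤ j)

-- f(n,t,r) = v : v is attained by some admissible graph and bounds the
-- rainbow girth of every admissible graph.
FIs : ℕ → ℕ → ℕ → ℕ∞ → Set
FIs n t r v =
  (∃ λ (G : ECGraph n) → Admissible n t r G × RainbowGirth G v) ×
  (∀ (G : ECGraph n) w → Admissible n t r G → RainbowGirth G w → w ≤∞ v)

module Submission where

-- In a loopless graph, any more than n C 2 edges contain two parallel ones (pigeonhole on
-- endpoint pairs). If one colour class has more than n C 2 edges, simplicity therefore forces a loop;
-- if the three classes together do, there is a loop or two parallel edges of different colours, a
-- rainbow 2-cycle. The bounds are attained by r loops in each colour, and by r vertex pairs each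
-- carrying three parallel edges of different colours.
-- For r ≤ ⌊n C 2 / 3⌋, colour every edge of the complete graph by φ(v) for its larger endpoint v.
-- A rainbow cycle of length 2 or 3 is impossible, since its largest vertex meets two of its edges,
-- both of colour φ(v); a longer one would need four colours. Colour k has Σ {v | φ v = k} v edges,
-- and φ is balanced by a short prefix followed by the period 0 1 2 2 1 0, which adds the same
-- weight to all three colours in every block of six vertices.

open import Defs
open import Data.Nat
  using (ℕ; zero; suc; _≡ᵇ_; _+_; _*_; _∸_; _≤_; _<_; _/_; _%_; _⊔_; _⊓_; z≤n; s≤s; NonZero)
open import Data.Nat.Properties
open import Data.Nat.DivMod using (_divMod_; result; m*n/n≡m; /-monoˡ-≤; m<n*o⇒m/o<n; [m+kn]%n≡m%n)
open import Data.Nat.Combinatorics using (_C_; nC1≡n; nCk+nC[k+1]≡[n+1]C[k+1])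
open import Data.Nat.Tactic.RingSolver using (solve-∀)
open import Data.Fin as Fin using (Fin; zero; suc; toℕ; fromℕ<; inject₁; inject≤; remQuot; combine)
open import Data.Fin.Patterns using (0F; 1F; 2F; 3F; 4F; 5F)
import Data.Fin.Properties as Finₚ
open import Data.Product using (∃; ∃₂; _×_; _,_; proj₁; proj₂; uncurry)
open import Data.Product.Properties using (,-injectiveʳ)
open import Data.Sum using (_⊎_; inj₁; inj₂)
open import Data.Bool using (true; false; T; if_then_else_)
open import Data.List using (List; []; _∷_; _++_; map; length; lookup; filter; take; upTo; replicate)
import Data.List.Properties as Listₚ
open import Data.List.Relation.Unary.All as All using (All; []; _∷_)
import Data.List.Relation.Unary.All.Properties as Allₚ
open import Data.List.Relation.Unary.Any using (here; index)
open import Data.List.Relation.Unary.Any.Properties using (lookup-index)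
open import Data.List.Relation.Unary.AllPairs using ([]; _∷_)
open import Data.List.Relation.Unary.Unique.Propositional using (Unique)
import Data.List.Relation.Unary.Unique.Propositional.Properties as Uniqueₚ
open import Data.List.Membership.Propositional using (_∈_)
open import Data.List.Relation.Binary.Disjoint.Propositional using (Disjoint)
import Data.List.Membership.Propositional.Properties as ∈ₚ
open import Relation.Binary.PropositionalEquality
open import Relation.Binary using (tri<; tri≈; tri>)
open import Relation.Nullary using (¬_; Dec; yes; no; contradiction)
open import Relation.Nullary.Decidable using (toWitness)
open import Data.Empty using (⊥; ⊥-elim)
open import Data.Unit using (tt)
open import Function using (_∘_)
open import Function.Definitions using (Injective)

-- Triangular numbers and a code for unordered pairs

triangle : ℕ → ℕ
triangle zero    = 0
triangle (suc m) = triangle m + m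

nC2≡triangle : ∀ n → n C 2 ≡ triangle n
nC2≡triangle zero    = refl
nC2≡triangle (suc n) = begin
  suc n C 2      ≡⟨ sym (nCk+nC[k+1]≡[n+1]C[k+1] n 1) ⟩
  n C 1 + n C 2  ≡⟨ cong₂ _+_ (nC1≡n n) (nC2≡triangle n) ⟩
  n + triangle n ≡⟨ +-comm n (triangle n) ⟩
  triangle n + n ∎
  where open ≡-Reasoning

triangle-mono-≤ : ∀ {a b} → a ≤ b → triangle a ≤ triangle b
triangle-mono-≤ z≤n       = z≤n
triangle-mono-≤ (s≤s a≤b) = +-mono-≤ (triangle-mono-≤ a≤b) a≤b

triangle+<triangle+ : ∀ {a b a′ b′} → a < b → b < b′ → triangle b + a < triangle b′ + a′
triangle+<triangle+ {a′ = a′} {b′} a<b b<b′ =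
  ≤-trans (+-monoʳ-< _ a<b) (≤-trans (triangle-mono-≤ b<b′) (m≤m+n (triangle b′) a′))

triangle+-injective : ∀ {a b a′ b′} → a < b → a′ < b′ →
  triangle b + a ≡ triangle b′ + a′ → a ≡ a′ × b ≡ b′
triangle+-injective {a} {b} {a′} {b′} a<b a′<b′ eq with <-cmp b b′
... | tri< b<b′ _ _ = ⊥-elim (<-irrefl eq (triangle+<triangle+ a<b b<b′))
... | tri≈ _ refl _ = +-cancelˡ-≡ (triangle b) a a′ eq , refl
... | tri> _ _ b′<b = ⊥-elim (<-irrefl (sym eq) (triangle+<triangle+ a′<b′ b′<b))

pairCode : ℕ → ℕ → ℕ
pairCode x y = triangle (x ⊔ y) + x ⊓ y

pairCode-sorted : ∀ x y → x ≢ y →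
  ∃₂ λ a b → a < b × pairCode x y ≡ triangle b + a × ((x ≡ a × y ≡ b) ⊎ (x ≡ b × y ≡ a))
pairCode-sorted x y x≢y with <-cmp x y
... | tri< x<y _ _ = x , y , x<y ,
      cong₂ (λ u v → triangle u + v) (m≤n⇒m⊔n≡n (<⇒≤ x<y)) (m≤n⇒m⊓n≡m (<⇒≤ x<y)) ,
      inj₁ (refl , refl)
... | tri≈ _ x≡y _ = ⊥-elim (x≢y x≡y)
... | tri> _ _ y<x = y , x , y<x ,
      cong₂ (λ u v → triangle u + v) (m≥n⇒m⊔n≡m (<⇒≤ y<x)) (m≥n⇒m⊓n≡n (<⇒≤ y<x)) ,
      inj₂ (refl , refl)

pairCode<nC2 : ∀ {n x y} → x < n → y < n → x ≢ y → pairCode x y < n C 2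
pairCode<nC2 {n} {x} {y} x<n y<n x≢y with pairCode-sorted x y x≢y
... | a , b , a<b , code≡ , ends = begin-strict
  pairCode x y   ≡⟨ code≡ ⟩
  triangle b + a <⟨ +-monoʳ-< (triangle b) a<b ⟩
  triangle (suc b) ≤⟨ triangle-mono-≤ (larger<n ends) ⟩
  triangle n     ≡⟨ nC2≡triangle n ⟨
  n C 2          ∎
  where
  open ≤-Reasoning
  larger<n : ∀ {a} → (x ≡ a × y ≡ b) ⊎ (x ≡ b × y ≡ a) → b < n
  larger<n (inj₁ (_ , refl)) = y<n
  larger<n (inj₂ (refl , _)) = x<n

pairCode-injective : ∀ {x y x′ y′} → x ≢ y → x′ ≢ y′ → pairCode x y ≡ pairCode x′ y′ →
  (x ≡ x′ × y ≡ y′) ⊎ (x ≡ y′ × y ≡ x′)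
pairCode-injective {x} {y} {x′} {y′} x≢y x′≢y′ eq
  with pairCode-sorted x y x≢y | pairCode-sorted x′ y′ x′≢y′
... | a , b , a<b , code≡ , ends | a′ , b′ , a′<b′ , code≡′ , ends′
  with triangle+-injective a<b a′<b′ (trans (sym code≡) (trans eq code≡′))
... | refl , refl with ends | ends′
... | inj₁ (refl , refl) | inj₁ (refl , refl) = inj₁ (refl , refl)
... | inj₁ (refl , refl) | inj₂ (refl , refl) = inj₂ (refl , refl)
... | inj₂ (refl , refl) | inj₁ (refl , refl) = inj₂ (refl , refl)
... | inj₂ (refl , refl) | inj₂ (refl , refl) = inj₁ (refl , refl)

m/n<o⇒m<o*n : ∀ {m n o} .{{_ : NonZero n}} → m / n < o → m < o * n
m/n<o⇒m<o*n {m} {n} {o} m/n<o =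
  ≰⇒> λ o*n≤m → <⇒≱ m/n<o (subst (_≤ m / n) (m*n/n≡m o n) (/-monoˡ-≤ n o*n≤m))


module _ {A : Set} where

  lookup-All : ∀ {P : A → Set} {xs : List A} → All P xs → ∀ i → P (lookup xs i)
  lookup-All ps i = All.lookup ps (∈ₚ.∈-lookup i)

  lookup-injective : ∀ {xs : List A} → Unique xs → ∀ i j → lookup xs i ≡ lookup xs j → i ≡ j
  lookup-injective (_ ∷ _)   zero    zero    _  = refl
  lookup-injective (x∉ ∷ _)  zero    (suc j) eq = ⊥-elim (lookup-All x∉ j eq)
  lookup-injective (x∉ ∷ _)  (suc i) zero    eq = ⊥-elim (lookup-All x∉ i (sym eq))
  lookup-injective (_ ∷ xs!) (suc i) (suc j) eq = cong suc (lookup-injective xs! i j eq)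

  unique-map⁺ : ∀ {B : Set} {P : A → Set} (f : A → B) →
    (∀ {x y} → P x → P y → f x ≡ f y → x ≡ y) →
    ∀ {xs} → All P xs → Unique xs → Unique (map f xs)
  unique-map⁺ f inj [] [] = []
  unique-map⁺ {P = P} f inj {x ∷ xs} (px ∷ pxs) (x∉ ∷ xs!) = fresh pxs x∉ ∷ unique-map⁺ f inj pxs xs!
    where
    fresh : ∀ {ys} → All P ys → All (x ≢_) ys → All (f x ≢_) (map f ys)
    fresh []         []         = []
    fresh (py ∷ pys) (x≢y ∷ x∉) = (x≢y ∘ inj px py) ∷ fresh pys x∉


module _ {n : ℕ} where

  Loop : Edge n → Set
  Loop e = end₁ e ≡ end₂ e

  Ascending : Edge n → Set
  Ascending e = toℕ (end₁ e) < toℕ (end₂ e)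

  loop? : (G : ECGraph n) → Dec (∃ λ (i : EdgeIx G) → Loop (lookup G i))
  loop? G = Finₚ.any? (λ i → end₁ (lookup G i) Fin.≟ end₂ (lookup G i))

  classSize-++ : (G H : ECGraph n) (c : ℕ) → classSize (G ++ H) c ≡ classSize G c + classSize H c
  classSize-++ G H c =
    trans (cong length (Listₚ.filter-++ (λ e → colour e ≟ c) G H)) (Listₚ.length-++ (filter (λ e → colour e ≟ c) G))

  classSize-all : ∀ {G : ECGraph n} {c} → All (λ e → colour e ≡ c) G → classSize G c ≡ length G
  classSize-all {c = c} ≡c = cong length (Listₚ.filter-all (λ e → colour e ≟ c) ≡c)

  classSize-none : ∀ {G : ECGraph n} {c} → All (λ e → colour e ≢ c) G → classSize G c ≡ 0
  classSize-none {c = c} ≢c = cong length (Listₚ.filter-none (λ e → colour e ≟ c) ≢c)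

  classSize-uniform : ∀ {G : ECGraph n} {c} d → All (λ e → colour e ≡ c) G →
    classSize G d ≡ (if c ≡ᵇ d then length G else 0)
  classSize-uniform {c = c} d ≡c with c ≡ᵇ d in c≡ᵇd
  ... | true  = classSize-all (All.map (λ e≡c → trans e≡c (≡ᵇ⇒≡ c d (subst T (sym c≡ᵇd) tt))) ≡c)
  ... | false = classSize-none (All.map (λ e≡c e≡d → subst T c≡ᵇd (≡⇒≡ᵇ c d (trans (sym e≡c) e≡d))) ≡c)

  classMember : (G : ECGraph n) (c : ℕ) → Fin (classSize G c) → EdgeIx G
  classMember (e ∷ G) c k with colour e ≡ᵇ c
  classMember (e ∷ G) c zero    | true = zero
  classMember (e ∷ G) c (suc k) | true = suc (classMember G c k)
  ... | false = suc (classMember G c k)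

  classMember-colour : (G : ECGraph n) (c : ℕ) (k : Fin (classSize G c)) → col G (classMember G c k) ≡ c
  classMember-colour (e ∷ G) c k with colour e ≡ᵇ c in e≡ᵇc
  classMember-colour (e ∷ G) c zero    | true = ≡ᵇ⇒≡ (colour e) c (subst T (sym e≡ᵇc) tt)
  classMember-colour (e ∷ G) c (suc k) | true = classMember-colour G c k
  ... | false = classMember-colour G c k

  classMember-injective : (G : ECGraph n) (c : ℕ) → Injective _≡_ _≡_ (classMember G c)
  classMember-injective (e ∷ G) c {k} {l} eq with colour e ≡ᵇ c
  classMember-injective (e ∷ G) c {zero}  {zero}  eq | true = refl
  classMember-injective (e ∷ G) c {suc k} {suc l} eq | true =
    cong suc (classMember-injective G c (Finₚ.suc-injective eq))
  ... | false = classMember-injective G c (Finₚ.suc-injective eq)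

  edge-≡ : ∀ {e e′ : Edge n} →
    end₁ e ≡ end₁ e′ → end₂ e ≡ end₂ e′ → colour e ≡ colour e′ → e ≡ e′
  edge-≡ {edge _ _ _} refl refl refl = refl

  ascending-unique⇒simple : (G : ECGraph n) → All Ascending G → Unique G → Simple G
  ascending-unique⇒simple G asc G! i j i≢j same-colour (_ , inj₁ (p , q)) =
    i≢j (lookup-injective G! i j (edge-≡ (sym p) (sym q) same-colour))
  ascending-unique⇒simple G asc G! i j i≢j same-colour (_ , inj₂ (p , q)) =
    <-asym (lookup-All asc i) (subst₂ _<_ (cong toℕ p) (cong toℕ q) (lookup-All asc j))

  loops⇒simple : (G : ECGraph n) → All Loop G → Simple G
  loops⇒simple G loops i _ _ _ (not-loop , _) = not-loop (lookup-All loops i)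

  Joins-sym : ∀ (G : ECGraph n) {i x y} → Joins G i x y → Joins G i y x
  Joins-sym _ (inj₁ ends) = inj₂ ends
  Joins-sym _ (inj₂ ends) = inj₁ ends

  rainbowCycle⇒length≥1 : ∀ {G : ECGraph n} k → RainbowCycle G k → 1 ≤ k
  rainbowCycle⇒length≥1 (suc _) _ = s≤s z≤n

  loop⇒rainbowCycle : (G : ECGraph n) (i : EdgeIx G) → Loop (lookup G i) → RainbowCycle G 1
  loop⇒rainbowCycle G i loop =
    (λ _ → end₁ (lookup G i)) , (λ _ → i) , refl , (λ { {0F} {0F} _ → refl }) ,
    (λ { 0F → inj₁ (refl , sym loop) }) , (λ { {0F} {0F} _ → refl })

  parallel⇒rainbowCycle : (G : ECGraph n) (i j : EdgeIx G) → Parallel G i j →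
    col G i ≢ col G j → RainbowCycle G 2
  parallel⇒rainbowCycle G i j (not-loop , j-joins) colours≢ = vs , es , refl , vs-injective , joins , colours-injective
    where
    vs : Fin 3 → Fin n
    vs 0F = end₁ (lookup G i)
    vs 1F = end₂ (lookup G i)
    vs 2F = end₁ (lookup G i)
    es : Fin 2 → EdgeIx G
    es 0F = i
    es 1F = j
    vs-injective : Injective _≡_ _≡_ (vs ∘ inject₁)
    vs-injective {0F} {0F} _  = refl
    vs-injective {0F} {1F} eq = ⊥-elim (not-loop eq)
    vs-injective {1F} {0F} eq = ⊥-elim (not-loop (sym eq))
    vs-injective {1F} {1F} _  = refl
    joins : ∀ k → Joins G (es k) (vs (inject₁ k)) (vs (suc k))
    joins 0F = inj₁ (refl , refl)
    joins 1F = Joins-sym G j-joins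
    colours-injective : Injective _≡_ _≡_ (col G ∘ es)
    colours-injective {0F} {0F} _  = refl
    colours-injective {0F} {1F} eq = ⊥-elim (colours≢ eq)
    colours-injective {1F} {0F} eq = ⊥-elim (colours≢ (sym eq))
    colours-injective {1F} {1F} _  = refl

  ascending⇒no-rainbowCycle₁ : (G : ECGraph n) → All Ascending G → ¬ RainbowCycle G 1
  ascending⇒no-rainbowCycle₁ G asc (vs , es , closed , _ , joins , _) with joins 0F
  ... | inj₁ (p , q) = <-irrefl (cong toℕ (trans p (trans (sym closed) (sym q)))) (lookup-All asc (es 0F))
  ... | inj₂ (p , q) = <-irrefl (cong toℕ (trans p (trans closed (sym q)))) (lookup-All asc (es 0F))

  rainbowCycle⇒girth≤ : (G : ECGraph n) {k K : ℕ} (w : ℕ∞) → RainbowCycle G k → k ≤ K →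
    RainbowGirth G w → w ≤∞ fin K
  rainbowCycle⇒girth≤ G ∞       cycle _   acyclic         = ⊥-elim (acyclic _ cycle)
  rainbowCycle⇒girth≤ G (fin j) cycle k≤K (_ , shortest) = fin≤fin (≤-trans (shortest _ cycle) k≤K)

  admissible₃ : ∀ {r} (G : ECGraph n) → Simple G → All (λ e → colour e < 3) G → 1 ≤ r →
    (∀ (k : Fin 3) → r ≤ classSize G (toℕ k)) → Admissible n 3 r G
  admissible₃ {r} G simple colour<3 1≤r large = simple , (toℕ , Finₚ.toℕ-injective , used) , classes
    where
    used : ∀ k → Used G (toℕ k)
    used k = let m = fromℕ< (≤-trans 1≤r (large k)) in classMember G (toℕ k) m , classMember-colour G (toℕ k) m
    classes : ClassesAtLeast G r
    classes _ (i , refl) =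
      subst (λ c → r ≤ classSize G c) (Finₚ.toℕ-fromℕ< _) (large (fromℕ< (lookup-All colour<3 i)))

-- Upper bounds

module _ {n : ℕ} (G : ECGraph n) where

  edgeCode : ∀ (i : EdgeIx G) → ¬ Loop (lookup G i) → Fin (n C 2)
  edgeCode i not-loop =
    fromℕ< (pairCode<nC2 (Finₚ.toℕ<n (end₁ e)) (Finₚ.toℕ<n (end₂ e)) (not-loop ∘ Finₚ.toℕ-injective))
    where e = lookup G i

  parallel-pigeonhole : ∀ {K} (h : Fin K → EdgeIx G) → Injective _≡_ _≡_ h → n C 2 < K →
    (∀ k → ¬ Loop (lookup G (h k))) → ∃₂ λ k l → h k ≢ h l × Parallel G (h k) (h l)
  parallel-pigeonhole h h-injective n<K loopless
    with Finₚ.pigeonhole n<K (λ k → edgeCode (h k) (loopless k))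
  ... | k , l , k<l , codes≡ = k , l , Finₚ.<⇒≢ k<l ∘ h-injective , loopless k , joins
    where
    e = lookup G (h k)
    joins : Joins G (h l) (end₁ e) (end₂ e)
    joins with pairCode-injective (loopless k ∘ Finₚ.toℕ-injective) (loopless l ∘ Finₚ.toℕ-injective)
                 (Finₚ.fromℕ<-injective _ _ _ _ codes≡)
    ... | inj₁ (p , q) = inj₁ (sym (Finₚ.toℕ-injective p) , sym (Finₚ.toℕ-injective q))
    ... | inj₂ (p , q) = inj₂ (sym (Finₚ.toℕ-injective q) , sym (Finₚ.toℕ-injective p))

module _ {n t r : ℕ} (G : ECGraph n) (adm : Admissible n t r G) where

  private
    simple : Simple G
    simple = proj₁ adm
    colours : Fin t → ℕ
    colours = proj₁ (proj₁ (proj₂ adm))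
    colours-injective : Injective _≡_ _≡_ colours
    colours-injective = proj₁ (proj₂ (proj₁ (proj₂ adm)))
    used : ∀ k → Used G (colours k)
    used = proj₂ (proj₂ (proj₁ (proj₂ adm)))
    large : ClassesAtLeast G r
    large = proj₂ (proj₂ adm)
    classEdge : Fin t × Fin r → EdgeIx G
    classEdge (k , a) = classMember G (colours k) (inject≤ a (large _ (used k)))
    classEdge-colour : ∀ k a → col G (classEdge (k , a)) ≡ colours k
    classEdge-colour k a = classMember-colour G (colours k) _
    classEdge-injective : Injective _≡_ _≡_ classEdge
    classEdge-injective {k , a} {l , b} eq
      with colours-injective (trans (sym (classEdge-colour k a)) (trans (cong (col G) eq) (classEdge-colour l b)))
    ... | refl = cong (k ,_) (Finₚ.inject≤-injective _ _ a b (classMember-injective G (colours k) eq))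
    spread : Fin (t * r) → EdgeIx G
    spread = classEdge ∘ remQuot r
    spread-injective : Injective _≡_ _≡_ spread
    spread-injective {x} {y} eq = begin
      x                                  ≡⟨ Finₚ.combine-remQuot {t} r x ⟨
      uncurry combine (remQuot {t} r x)  ≡⟨ cong (uncurry combine) (classEdge-injective eq) ⟩
      uncurry combine (remQuot {t} r y)  ≡⟨ Finₚ.combine-remQuot {t} r y ⟩
      y                                  ∎
      where open ≡-Reasoning

  rainbowGirth≤1 : Fin t → n C 2 < r → ∀ w → RainbowGirth G w → w ≤∞ fin 1
  rainbowGirth≤1 k n<r w girth = by-loops (loop? G)
    where
    by-loops : Dec (∃ λ (i : EdgeIx G) → Loop (lookup G i)) → w ≤∞ fin 1
    by-loops (yes (i , loop)) = rainbowCycle⇒girth≤ G w (loop⇒rainbowCycle G i loop) ≤-refl girth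
    by-loops (no loopless) =
      let a , b , a≢b , parallel = parallel-pigeonhole G (classEdge ∘ (k ,_)) (,-injectiveʳ ∘ classEdge-injective)
                                     n<r (λ a loop → loopless (classEdge (k , a) , loop))
      in ⊥-elim (simple (classEdge (k , a)) (classEdge (k , b)) a≢b
                   (trans (classEdge-colour k a) (sym (classEdge-colour k b))) parallel)

  rainbowGirth≤2 : n C 2 < t * r → ∀ w → RainbowGirth G w → w ≤∞ fin 2
  rainbowGirth≤2 n<tr w girth = by-loops (loop? G)
    where
    by-loops : Dec (∃ λ (i : EdgeIx G) → Loop (lookup G i)) → w ≤∞ fin 2
    by-loops (yes (i , loop)) = rainbowCycle⇒girth≤ G w (loop⇒rainbowCycle G i loop) (s≤s z≤n) girth
    by-loops (no loopless) =
      let x , y , x≢y , parallel = parallel-pigeonhole G spread spread-injective n<tr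
                                     (λ x loop → loopless (spread x , loop))
      in by-colours x≢y parallel (col G (spread x) ≟ col G (spread y))
      where
      by-colours : ∀ {i j} → i ≢ j → Parallel G i j → Dec (col G i ≡ col G j) → w ≤∞ fin 2
      by-colours i≢j parallel (yes same)      = ⊥-elim (simple _ _ i≢j same parallel)
      by-colours i≢j parallel (no different)  =
        rainbowCycle⇒girth≤ G w (parallel⇒rainbowCycle G _ _ parallel different) ≤-refl girth

-- Constructions from lists of vertex pairs

-- Numbers above m are clamped to m; every use below is on numbers < suc m.
vertex : ∀ {m} → ℕ → Fin (suc m)
vertex {m} x = fromℕ< (s≤s (m⊓n≤n x m))

toℕ-vertex : ∀ {m x} → x < suc m → toℕ (vertex {m} x) ≡ x
toℕ-vertex (s≤s x≤m) = trans (Finₚ.toℕ-fromℕ< _) (m≤n⇒m⊓n≡m x≤m)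

vertex-injective : ∀ {m x y} → x < suc m → y < suc m → vertex {m} x ≡ vertex y → x ≡ y
vertex-injective x<n y<n eq = trans (sym (toℕ-vertex x<n)) (trans (cong toℕ eq) (toℕ-vertex y<n))

pairs : ℕ → List (ℕ × ℕ)
pairs zero    = []
pairs (suc m) = pairs m ++ map (_, m) (upTo m)

SortedBelow : ℕ → ℕ × ℕ → Set
SortedBelow m (a , b) = a < b × b < m

pairs-sortedBelow : ∀ m → All (SortedBelow m) (pairs m)
pairs-sortedBelow zero    = []
pairs-sortedBelow (suc m) = Allₚ.++⁺ (All.map (λ { (a<b , b<m) → a<b , m<n⇒m<1+n b<m }) (pairs-sortedBelow m))
  (Allₚ.map⁺ (Allₚ.applyUpTo⁺₁ (λ i → i) m (_, ≤-refl)))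

pairs-unique : ∀ m → Unique (pairs m)
pairs-unique zero    = []
pairs-unique (suc m) = Uniqueₚ.++⁺ (pairs-unique m) (Uniqueₚ.map⁺ (cong proj₁) (Uniqueₚ.upTo⁺ m)) disjoint
  where
  disjoint : ∀ {p} → ¬ (p ∈ pairs m × p ∈ map (_, m) (upTo m))
  disjoint (p∈old , p∈new) with ∈ₚ.∈-map⁻ (_, m) p∈new
  ... | _ , _ , refl = <-irrefl refl (proj₂ (All.lookup (pairs-sortedBelow m) p∈old))

length-pairs : ∀ m → length (pairs m) ≡ triangle m
length-pairs zero    = refl
length-pairs (suc m) = trans (Listₚ.length-++ (pairs m))
  (cong₂ _+_ (length-pairs m) (trans (Listₚ.length-map (_, m) (upTo m)) (Listₚ.length-upTo m)))

module _ {m : ℕ} where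

  pairEdge : ℕ → ℕ × ℕ → Edge (suc m)
  pairEdge c (a , b) = edge (vertex a) (vertex b) c

  pairEdge-ascending : ∀ c {p} → SortedBelow (suc m) p → Ascending (pairEdge c p)
  pairEdge-ascending c {a , b} (a<b , b<n) rewrite toℕ-vertex (<-trans a<b b<n) | toℕ-vertex b<n = a<b

  pairEdge-injective : ∀ {c d p q} → SortedBelow (suc m) p → SortedBelow (suc m) q →
    pairEdge c p ≡ pairEdge d q → p ≡ q
  pairEdge-injective (a<b , b<n) (a′<b′ , b′<n) eq =
    cong₂ _,_ (vertex-injective (<-trans a<b b<n) (<-trans a′<b′ b′<n) (cong end₁ eq))
              (vertex-injective b<n b′<n (cong end₂ eq))

  tripled : List (ℕ × ℕ) → ECGraph (suc m)
  tripled ps = map (pairEdge 0) ps ++ map (pairEdge 1) ps ++ map (pairEdge 2) ps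

  pairEdges-coloured : ∀ c ps → All (λ e → colour e ≡ c) (map (pairEdge c) ps)
  pairEdges-coloured c ps = Allₚ.map⁺ (All.universal (λ _ → refl) ps)

  classSize-tripled : ∀ ps (k : Fin 3) → classSize (tripled ps) (toℕ k) ≡ length ps
  classSize-tripled ps k = begin
    classSize (tripled ps) (toℕ k)
      ≡⟨ classSize-++ (edges 0) _ (toℕ k) ⟩
    classOf 0 + classSize (edges 1 ++ edges 2) (toℕ k)
      ≡⟨ cong (classOf 0 +_) (classSize-++ (edges 1) (edges 2) (toℕ k)) ⟩
    classOf 0 + (classOf 1 + classOf 2)
      ≡⟨ cong₂ _+_ (classOf≡ 0) (cong₂ _+_ (classOf≡ 1) (classOf≡ 2)) ⟩
    share 0 k + (share 1 k + share 2 k)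
      ≡⟨ one-share k ⟩
    length ps ∎
    where
    open ≡-Reasoning
    edges : ℕ → ECGraph (suc m)
    edges c = map (pairEdge c) ps
    classOf : ℕ → ℕ
    classOf c = classSize (edges c) (toℕ k)
    share : ℕ → Fin 3 → ℕ
    share c k = if c ≡ᵇ toℕ k then length ps else 0
    classOf≡ : ∀ c → classOf c ≡ share c k
    classOf≡ c = trans (classSize-uniform (toℕ k) (pairEdges-coloured c ps))
      (cong (λ len → if c ≡ᵇ toℕ k then len else 0) (Listₚ.length-map (pairEdge c) ps))
    one-share : ∀ k → share 0 k + (share 1 k + share 2 k) ≡ length ps
    one-share 0F = +-identityʳ (length ps)
    one-share 1F = +-identityʳ (length ps)
    one-share 2F = refl

  tripled-All : ∀ {P : Edge (suc m) → Set} ps →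
    (∀ (k : Fin 3) → All (P ∘ pairEdge (toℕ k)) ps) → All P (tripled ps)
  tripled-All ps all = Allₚ.++⁺ (Allₚ.map⁺ (all 0F)) (Allₚ.++⁺ (Allₚ.map⁺ (all 1F)) (Allₚ.map⁺ (all 2F)))

  tripled-admissible : ∀ {r} ps → Simple (tripled ps) → 1 ≤ r → r ≤ length ps →
    Admissible (suc m) 3 r (tripled ps)
  tripled-admissible ps simple 1≤r r≤len =
    admissible₃ (tripled ps) simple (tripled-All ps (λ k → All.universal (λ _ → Finₚ.toℕ<n k) ps)) 1≤r
      (λ k → subst (_ ≤_) (sym (classSize-tripled ps k)) r≤len)

  tripled-unique : ∀ {ps} → All (SortedBelow (suc m)) ps → Unique ps → Unique (tripled ps)
  tripled-unique {ps} sorted ps! =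
    Uniqueₚ.++⁺ (copy 0)
      (Uniqueₚ.++⁺ (copy 1) (copy 2) (different-colours 1 (pairEdges-coloured 1 ps) (uncoloured 2 1 λ ())))
      (different-colours 0 (pairEdges-coloured 0 ps) (Allₚ.++⁺ (uncoloured 1 0 λ ()) (uncoloured 2 0 λ ())))
    where
    copy : ∀ c → Unique (map (pairEdge c) ps)
    copy c = unique-map⁺ (pairEdge c) pairEdge-injective sorted ps!
    uncoloured : ∀ c d → c ≢ d → All (λ e → colour e ≢ d) (map (pairEdge c) ps)
    uncoloured c d c≢d = Allₚ.map⁺ (All.universal (λ _ → c≢d) ps)
    different-colours : ∀ c {G H : ECGraph (suc m)} →
      All (λ e → colour e ≡ c) G → All (λ e → colour e ≢ c) H → Disjoint G H
    different-colours c ≡c ≢c (e∈G , e∈H) = All.lookup ≢c e∈H (All.lookup ≡c e∈G)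

  tripled-simple : ∀ {ps} → All (SortedBelow (suc m)) ps → Unique ps → Simple (tripled ps)
  tripled-simple {ps} sorted ps! = ascending-unique⇒simple (tripled ps)
    (tripled-All ps (λ k → All.map (pairEdge-ascending (toℕ k)) sorted)) (tripled-unique sorted ps!)

  loops-rainbowGirth₁ : ∀ r → 1 ≤ r →
    ∃ λ (G : ECGraph (suc m)) → Admissible (suc m) 3 r G × RainbowGirth G (fin 1)
  loops-rainbowGirth₁ r@(suc _) 1≤r = tripled loops ,
    tripled-admissible loops (loops⇒simple (tripled loops) (tripled-All loops λ _ → Allₚ.replicate⁺ r refl)) 1≤r
      (≤-reflexive (sym (Listₚ.length-replicate r))) ,
    loop⇒rainbowCycle (tripled loops) zero refl , rainbowCycle⇒length≥1
    where
    loops = replicate r (0 , 0)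

  tripled-rainbowGirth₂ : ∀ {p ps} → All (SortedBelow (suc m)) (p ∷ ps) →
    RainbowGirth (tripled (p ∷ ps)) (fin 2)
  tripled-rainbowGirth₂ {p} {ps} sorted = parallel⇒rainbowCycle G zero j (not-loop , joins) different , shortest
    where
    G = tripled (p ∷ ps)
    ascending : All Ascending G
    ascending = tripled-All (p ∷ ps) (λ k → All.map (pairEdge-ascending (toℕ k)) sorted)
    second : pairEdge 1 p ∈ G
    second = ∈ₚ.∈-++⁺ʳ (map (pairEdge 0) (p ∷ ps))
      (∈ₚ.∈-++⁺ˡ {xs = map (pairEdge 1) (p ∷ ps)} {ys = map (pairEdge 2) (p ∷ ps)} (here refl))
    j : EdgeIx G
    j = index second
    not-loop : ¬ Loop (lookup G zero)
    not-loop loop = <-irrefl (cong toℕ loop) (lookup-All ascending zero)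
    different : col G zero ≢ col G j
    different eq = 0≢1+n (trans eq (cong colour (sym (lookup-index second))))
    joins : Joins G j (vertex (proj₁ p)) (vertex (proj₂ p))
    joins = inj₁ (cong end₁ (sym (lookup-index second)) , cong end₂ (sym (lookup-index second)))
    shortest : ∀ k → RainbowCycle G k → 2 ≤ k
    shortest 1 cycle = ⊥-elim (ascending⇒no-rainbowCycle₁ G ascending cycle)
    shortest (suc (suc _)) _ = s≤s (s≤s z≤n)

  pairs-rainbowGirth₂ : ∀ r → 1 ≤ r → r ≤ suc m C 2 →
    ∃ λ (G : ECGraph (suc m)) → Admissible (suc m) 3 r G × RainbowGirth G (fin 2)
  pairs-rainbowGirth₂ r 1≤r r≤nC2 =
    girth₂ (take r (pairs (suc m))) (Allₚ.take⁺ r (pairs-sortedBelow (suc m))) (Uniqueₚ.take⁺ r (pairs-unique (suc m)))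
      length-take
    where
    length-take : length (take r (pairs (suc m))) ≡ r
    length-take = trans (Listₚ.length-take r (pairs (suc m)))
      (m≤n⇒m⊓n≡m (subst (r ≤_) (trans (nC2≡triangle (suc m)) (sym (length-pairs (suc m)))) r≤nC2))
    girth₂ : ∀ ps → All (SortedBelow (suc m)) ps → Unique ps → length ps ≡ r →
      ∃ λ (G : ECGraph (suc m)) → Admissible (suc m) 3 r G × RainbowGirth G (fin 2)
    girth₂ []       _      _   0≡r   = ⊥-elim (<-irrefl 0≡r 1≤r)
    girth₂ (p ∷ ps) sorted ps! len≡r = tripled (p ∷ ps) ,
      tripled-admissible (p ∷ ps) (tripled-simple sorted ps!) 1≤r (≤-reflexive (sym len≡r)) ,
      tripled-rainbowGirth₂ sorted

-- Colouring every edge by its larger endpoint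

-- The largest vertex of a triangle is the larger endpoint of two of its sides.
shared-max : ∀ x y z → x ⊔ y ≡ y ⊔ z ⊎ (y ⊔ z ≡ z ⊔ x ⊎ z ⊔ x ≡ x ⊔ y)
shared-max x y z with ≤-total x y
... | inj₁ x≤y with ≤-total y z
...   | inj₁ y≤z = inj₂ (inj₁ (trans (m≤n⇒m⊔n≡n y≤z) (sym (m≥n⇒m⊔n≡m (≤-trans x≤y y≤z)))))
...   | inj₂ z≤y = inj₁ (trans (m≤n⇒m⊔n≡n x≤y) (sym (m≥n⇒m⊔n≡m z≤y)))
shared-max x y z | inj₂ y≤x with ≤-total x z
...   | inj₁ x≤z = inj₂ (inj₁ (trans (m≤n⇒m⊔n≡n (≤-trans y≤x x≤z)) (sym (m≥n⇒m⊔n≡m x≤z))))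
...   | inj₂ z≤x = inj₂ (inj₂ (trans (m≤n⇒m⊔n≡n z≤x) (sym (m≥n⇒m⊔n≡m y≤x))))

module _ {n : ℕ} (φ : ℕ → Fin 3) where

  ColouredByMax : Edge n → Set
  ColouredByMax e = Ascending e × colour e ≡ toℕ (φ (toℕ (end₂ e)))

  module _ {G : ECGraph n} (byMax : All ColouredByMax G) where

    joins⇒colour : ∀ i {x y} → Joins G i x y → col G i ≡ toℕ (φ (toℕ x ⊔ toℕ y))
    joins⇒colour i (inj₁ (refl , refl)) with lookup-All byMax i
    ... | x<y , colour≡ = trans colour≡ (cong (toℕ ∘ φ) (sym (m≤n⇒m⊔n≡n (<⇒≤ x<y))))
    joins⇒colour i (inj₂ (refl , refl)) with lookup-All byMax i
    ... | y<x , colour≡ = trans colour≡ (cong (toℕ ∘ φ) (sym (m≥n⇒m⊔n≡m (<⇒≤ y<x))))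

    same-max⇒same-colour : ∀ i j {x y x′ y′} → Joins G i x y → Joins G j x′ y′ →
      toℕ x ⊔ toℕ y ≡ toℕ x′ ⊔ toℕ y′ → col G i ≡ col G j
    same-max⇒same-colour i j i-joins j-joins max≡ =
      trans (joins⇒colour i i-joins) (trans (cong (toℕ ∘ φ) max≡) (sym (joins⇒colour j j-joins)))

    no-rainbowCycle : ∀ k → ¬ RainbowCycle G k
    no-rainbowCycle 1 cycle = ascending⇒no-rainbowCycle₁ G (All.map proj₁ byMax) cycle
    no-rainbowCycle 2 (vs , es , closed , _ , joins , rainbow) =
      contradiction (rainbow {0F} {1F} (same-max⇒same-colour (es 0F) (es 1F) (joins 0F) joins₁
        (⊔-comm (toℕ (vs 0F)) (toℕ (vs 1F))))) λ ()
      where joins₁ = subst (Joins G (es 1F) (vs 1F)) closed (joins 1F)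
    no-rainbowCycle 3 (vs , es , closed , _ , joins , rainbow) =
      by-shared-max (shared-max (toℕ (vs 0F)) (toℕ (vs 1F)) (toℕ (vs 2F)))
      where
      joins₂ = subst (Joins G (es 2F) (vs 2F)) closed (joins 2F)
      by-shared-max : _ ⊎ (_ ⊎ _) → ⊥
      by-shared-max (inj₁ max≡) =
        contradiction (rainbow {0F} {1F} (same-max⇒same-colour (es 0F) (es 1F) (joins 0F) (joins 1F) max≡)) λ ()
      by-shared-max (inj₂ (inj₁ max≡)) =
        contradiction (rainbow {1F} {2F} (same-max⇒same-colour (es 1F) (es 2F) (joins 1F) joins₂ max≡)) λ ()
      by-shared-max (inj₂ (inj₂ max≡)) =
        contradiction (rainbow {2F} {0F} (same-max⇒same-colour (es 2F) (es 0F) joins₂ (joins 0F) max≡)) λ ()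
    no-rainbowCycle (suc (suc (suc (suc k)))) (vs , es , _ , _ , _ , rainbow) =
      let i , j , i<j , colours≡ = Finₚ.pigeonhole (s≤s (s≤s (s≤s (s≤s z≤n)))) (λ i → fromℕ< (colour<3 (es i)))
      in Finₚ.<⇒≢ i<j (rainbow (Finₚ.fromℕ<-injective _ _ _ _ colours≡))
      where
      colour<3 : ∀ i → col G i < 3
      colour<3 i = subst (_< 3) (sym (proj₂ (lookup-All byMax i))) (Finₚ.toℕ<n _)

weight : (ℕ → Fin 3) → Fin 3 → ℕ → ℕ
weight φ k zero    = 0
weight φ k (suc v) = weight φ k v + (if toℕ (φ v) ≡ᵇ toℕ k then v else 0)

module _ {m : ℕ} (φ : ℕ → Fin 3) where

  maxEdge : ℕ × ℕ → Edge (suc m)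
  maxEdge p = pairEdge (toℕ (φ (proj₂ p))) p

  maxColoured : ECGraph (suc m)
  maxColoured = map maxEdge (pairs (suc m))

  maxColoured-byMax : All (ColouredByMax φ) maxColoured
  maxColoured-byMax = Allₚ.map⁺ (All.map byMax (pairs-sortedBelow (suc m)))
    where
    byMax : ∀ {p} → SortedBelow (suc m) p → ColouredByMax φ (maxEdge p)
    byMax {a , b} sorted@(_ , b<n) = pairEdge-ascending (toℕ (φ b)) sorted , cong (toℕ ∘ φ) (sym (toℕ-vertex b<n))

  maxColoured-simple : Simple maxColoured
  maxColoured-simple = ascending-unique⇒simple maxColoured (All.map proj₁ maxColoured-byMax)
    (unique-map⁺ maxEdge pairEdge-injective
      (pairs-sortedBelow (suc m)) (pairs-unique (suc m)))

  classSize-newest : ∀ v (k : Fin 3) →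
    classSize (map maxEdge (map (_, v) (upTo v))) (toℕ k) ≡ (if toℕ (φ v) ≡ᵇ toℕ k then v else 0)
  classSize-newest v k =
    trans (classSize-uniform (toℕ k) (Allₚ.map⁺ (Allₚ.map⁺ (All.universal (λ _ → refl) (upTo v)))))
      (cong (λ len → if toℕ (φ v) ≡ᵇ toℕ k then len else 0) length-newest)
    where
    length-newest : length (map maxEdge (map (_, v) (upTo v))) ≡ v
    length-newest = trans (Listₚ.length-map maxEdge (map (_, v) (upTo v)))
      (trans (Listₚ.length-map (_, v) (upTo v)) (Listₚ.length-upTo v))

  classSize-maxColoured : ∀ v (k : Fin 3) → classSize (map maxEdge (pairs v)) (toℕ k) ≡ weight φ k v
  classSize-maxColoured zero    k = refl
  classSize-maxColoured (suc v) k = begin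
    classSize (map maxEdge (pairs v ++ map (_, v) (upTo v))) (toℕ k)
      ≡⟨ cong (λ G → classSize G (toℕ k)) (Listₚ.map-++ maxEdge (pairs v) _) ⟩
    classSize (map maxEdge (pairs v) ++ map maxEdge (map (_, v) (upTo v))) (toℕ k)
      ≡⟨ classSize-++ (map maxEdge (pairs v)) _ (toℕ k) ⟩
    classSize (map maxEdge (pairs v)) (toℕ k) + classSize (map maxEdge (map (_, v) (upTo v))) (toℕ k)
      ≡⟨ cong₂ _+_ (classSize-maxColoured v k) (classSize-newest v k) ⟩
    weight φ k (suc v) ∎
    where open ≡-Reasoning

-- A vertex colouring with balanced weights

period : ℕ → Fin 3
period 0 = 0F
period 1 = 1F
period 2 = 2F
period 3 = 2F
period 4 = 1F
period _ = 0F

colourFrom : List (Fin 3) → ℕ → Fin 3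
colourFrom prefix v with v <? length prefix
... | yes v<len = lookup prefix (fromℕ< v<len)
... | no  _     = period ((v ∸ length prefix) % 6)

colourFrom-periodic : ∀ prefix q i → colourFrom prefix (i + (q * 6 + length prefix)) ≡ period (i % 6)
colourFrom-periodic prefix q i with i + (q * 6 + length prefix) <? length prefix
... | yes v<len = ⊥-elim (<⇒≱ v<len (≤-trans (m≤n+m _ (q * 6)) (m≤n+m _ i)))
... | no  _     = cong period (begin
  (i + (q * 6 + L) ∸ L) % 6 ≡⟨ cong (λ v → (v ∸ L) % 6) (+-assoc i (q * 6) L) ⟨
  (i + q * 6 + L ∸ L) % 6   ≡⟨ cong (_% 6) (m+n∸n≡m (i + q * 6) L) ⟩
  (i + q * 6) % 6           ≡⟨ [m+kn]%n≡m%n i q 6 ⟩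
  i % 6                     ∎)
  where
  open ≡-Reasoning
  L = length prefix

triangle-step : ∀ w → triangle (6 + w) ≡ triangle w + (6 * w + 15)
triangle-step w = lemma (triangle w) w
  where
  lemma : ∀ t w → t + w + (1 + w) + (2 + w) + (3 + w) + (4 + w) + (5 + w) ≡ t + (6 * w + 15)
  lemma = solve-∀

module _ (prefix : List (Fin 3)) (q : ℕ) where
  private
    φ = colourFrom prefix
    w = q * 6 + length prefix

  -- Every colour occupies two positions i and 5 ∸ i of the period, which add i + w and 5 ∸ i + w to its weight.
  weight-step : ∀ k → weight φ k (6 + w) ≡ weight φ k w + (2 * w + 5)
  weight-step k
    rewrite colourFrom-periodic prefix q 0 | colourFrom-periodic prefix q 1 | colourFrom-periodic prefix q 2
          | colourFrom-periodic prefix q 3 | colourFrom-periodic prefix q 4 | colourFrom-periodic prefix q 5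
    with k
  ... | 0F = lemma (weight φ 0F w) w
    where
    lemma : ∀ c w → c + w + 0 + 0 + 0 + 0 + (5 + w) ≡ c + (2 * w + 5)
    lemma = solve-∀
  ... | 1F = lemma (weight φ 1F w) w
    where
    lemma : ∀ c w → c + 0 + (1 + w) + 0 + 0 + (4 + w) + 0 ≡ c + (2 * w + 5)
    lemma = solve-∀
  ... | 2F = lemma (weight φ 2F w) w
    where
    lemma : ∀ c w → c + 0 + 0 + (2 + w) + (3 + w) + 0 + 0 ≡ c + (2 * w + 5)
    lemma = solve-∀

-- A division-free form of ⌊triangle v / 3⌋ ≤ weight φ k v.
Balanced : (ℕ → Fin 3) → Fin 3 → ℕ → Set
Balanced φ k v = triangle v < (1 + weight φ k v) * 3

periodic-balanced : ∀ prefix k → Balanced (colourFrom prefix) k (length prefix) →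
  ∀ q → Balanced (colourFrom prefix) k (q * 6 + length prefix)
periodic-balanced prefix k balanced zero    = balanced
periodic-balanced prefix k balanced (suc q) =
  subst (Balanced φ k) (+-assoc 6 (q * 6) (length prefix)) (begin-strict
    triangle (6 + w)                     ≡⟨ triangle-step w ⟩
    triangle w + (6 * w + 15)            <⟨ +-monoˡ-< (6 * w + 15) (periodic-balanced prefix k balanced q) ⟩
    (1 + weight φ k w) * 3 + (6 * w + 15) ≡⟨ lemma (weight φ k w) w ⟩
    (1 + (weight φ k w + (2 * w + 5))) * 3 ≡⟨ cong (λ c → (1 + c) * 3) (weight-step prefix q k) ⟨
    (1 + weight φ k (6 + w)) * 3          ∎)
  where
  open ≤-Reasoning
  φ = colourFrom prefix
  w = q * 6 + length prefix
  lemma : ∀ c w → (1 + c) * 3 + (6 * w + 15) ≡ (1 + (c + (2 * w + 5))) * 3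
  lemma = solve-∀

prefixes : Fin 6 → List (Fin 3)
prefixes 0F = 2F ∷ 1F ∷ 2F ∷ 2F ∷ 1F ∷ 0F ∷ []
prefixes 1F = 2F ∷ 0F ∷ 1F ∷ 2F ∷ 2F ∷ 1F ∷ 0F ∷ []
prefixes 2F = 2F ∷ 2F ∷ 0F ∷ 1F ∷ 2F ∷ 2F ∷ 1F ∷ 0F ∷ []
prefixes 3F = 2F ∷ 2F ∷ 2F ∷ 2F ∷ 0F ∷ 1F ∷ 2F ∷ 1F ∷ 0F ∷ []
prefixes 4F = 2F ∷ 2F ∷ 2F ∷ 2F ∷ 2F ∷ 2F ∷ 0F ∷ 1F ∷ 1F ∷ 0F ∷ []
prefixes 5F = 2F ∷ 2F ∷ 1F ∷ 2F ∷ 2F ∷ 2F ∷ 2F ∷ 1F ∷ 0F ∷ 1F ∷ 0F ∷ []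

length-prefixes : ∀ s → length (prefixes s) ≡ 6 + toℕ s
length-prefixes 0F = refl
length-prefixes 1F = refl
length-prefixes 2F = refl
length-prefixes 3F = refl
length-prefixes 4F = refl
length-prefixes 5F = refl

prefixes-balanced : ∀ s k → Balanced (colourFrom (prefixes s)) k (length (prefixes s))
prefixes-balanced = toWitness {a? = Finₚ.all? λ s → Finₚ.all? λ k → _ <? _} tt

≥6⇒prefix-decomposition : ∀ N → 6 ≤ N → ∃₂ λ q s → N ≡ q * 6 + length (prefixes s)
≥6⇒prefix-decomposition N 6≤N with N divMod 6
... | result zero    s N≡s   = ⊥-elim (<⇒≱ (subst (_< 6) (sym (trans N≡s (+-identityʳ _))) (Finₚ.toℕ<n s)) 6≤N)
... | result (suc q) s N≡s+q =
  q , s , trans N≡s+q (trans (lemma (toℕ s) q) (cong (q * 6 +_) (sym (length-prefixes s))))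
  where
  lemma : ∀ s q → s + (1 + q) * 6 ≡ q * 6 + (6 + s)
  lemma = solve-∀

balanced-colouring : ∀ N → 6 ≤ N → ∃ λ φ → ∀ k → (N C 2) / 3 ≤ weight φ k N
balanced-colouring N 6≤N with ≥6⇒prefix-decomposition N 6≤N
... | q , s , refl = φ , λ k →
  subst (λ t → t / 3 ≤ weight φ k N′) (sym (nC2≡triangle N′))
    (≤-pred (m<n*o⇒m/o<n {n = 1 + weight φ k N′} {o = 3}
      (periodic-balanced (prefixes s) k (prefixes-balanced s k) q)))
  where
  φ = colourFrom (prefixes s)
  N′ = q * 6 + length (prefixes s)

maxColoured-rainbowGirth∞ : ∀ {m r} → 6 ≤ suc m → 1 ≤ r → r ≤ (suc m C 2) / 3 →
  ∃ λ (G : ECGraph (suc m)) → Admissible (suc m) 3 r G × RainbowGirth G ∞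
maxColoured-rainbowGirth∞ {m} {r} 6≤n 1≤r r≤ with balanced-colouring (suc m) 6≤n
... | φ , heavy = G , admissible₃ G (maxColoured-simple φ) colour<3 1≤r large , no-rainbowCycle φ byMax
  where
  G = maxColoured {m} φ
  byMax = maxColoured-byMax φ
  colour<3 : All (λ e → colour e < 3) G
  colour<3 = All.map (λ { (_ , colour≡) → subst (_< 3) (sym colour≡) (Finₚ.toℕ<n _) }) byMax
  large : ∀ k → r ≤ classSize G (toℕ k)
  large k = ≤-trans r≤ (subst (_ ≤_) (sym (classSize-maxColoured φ (suc m) k)) (heavy k))

theorem2p18 : ∀ (n r : ℕ) → 100 ≤ n → 1 ≤ r →
    (r ≤ (n C 2) / 3 → FIs n 3 r ∞) ×
    ((n C 2) / 3 < r → r ≤ n C 2 → FIs n 3 r (fin 2)) ×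
    (n C 2 < r → FIs n 3 r (fin 1))
theorem2p18 (suc m) r 100≤n 1≤r = girth∞ , girth₂ , girth₁
  where
  n = suc m
  girth∞ : r ≤ (n C 2) / 3 → FIs n 3 r ∞
  girth∞ r≤nC2/3 = maxColoured-rainbowGirth∞ (≤-trans (m≤m+n 6 94) 100≤n) 1≤r r≤nC2/3 ,
    λ _ w _ _ → w ≤∞∞
  girth₂ : (n C 2) / 3 < r → r ≤ n C 2 → FIs n 3 r (fin 2)
  girth₂ nC2/3<r r≤nC2 = pairs-rainbowGirth₂ r 1≤r r≤nC2 ,
    λ G w adm → rainbowGirth≤2 G adm (subst (n C 2 <_) (*-comm r 3) (m/n<o⇒m<o*n {m = n C 2} {n = 3} nC2/3<r)) w
  girth₁ : n C 2 < r → FIs n 3 r (fin 1)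
  girth₁ nC2<r = loops-rainbowGirth₁ r 1≤r , λ G w adm → rainbowGirth≤1 G adm 0F nC2<r w
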